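{- In the natural deduction system for $\mathbf{PL}(\text{⩔})$ described below, for every classical formula $\alpha$ and all $\mathbf{PL}(\text{⩔})$-formulas $\phi,\psi$: (i) $\alpha\vee\phi,\neg\alpha\vdash\phi$; (ii) $\alpha\vee\phi,\neg\alpha\vee\psi\vdash\phi\vee\psi$.
   Context: Classical formulas: $\alpha::=p\mid\bot\mid\neg\alpha\mid\alpha\wedge\alpha\mid\alpha\vee\alpha$. $\mathbf{PL}(\text{⩔})$-formulas: $\phi::=p\mid\bot\mid\neg\phi\mid\phi\wedge\phi\mid\phi\vee\phi\mid\phi\,\text{⩔}\,\phi$ ($\vee$ is local, ⩔ global disjunction). The natural deduction system (with $\phi,\psi,\chi$ arbitrary and $\alpha$ ranging over classical formulas only; $[\cdot]$ marks discharged assumptions) has rules: $\bot$E: from $\bot$ infer $\phi$. $\wedge$I: from $\phi,\psi$ infer $\phi\wedge\psi$; $\wedge$E: from $\phi\wedge\psi$ infer $\phi$, and infer $\psi$. $\neg$I: from a derivation of $\bot$ from $[\phi]$ infer $\neg\phi$; $\neg$E: from $\phi$ and $\neg\phi$ infer $\psi$; RAA: from a derivation of $\bot$ from $[\neg\alpha]$ infer $\alpha$. ⩔I: from $\phi$ infer $\phi\,\text{⩔}\,\psi$ and $\psi\,\text{⩔}\,\phi$; ⩔E: from $\phi\,\text{⩔}\,\psi$, a derivation of $\chi$ from $[\phi]$ and one from $[\psi]$, infer $\chi$. $\vee$I: from $\phi$ infer $\phi\vee\psi$; $\vee$E: from $\phi\vee\psi$, a derivation of $\alpha$ from $[\phi]$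 and one from $[\psi]$, infer $\alpha$; $\vee$Com: from $\phi\vee\psi$ infer $\psi\vee\phi$; $\vee$Mon: from $\phi\vee\psi$ and a derivation of $\chi$ from $[\phi]$, infer $\chi\vee\psi$. Dis$\vee$⩔: from $\phi\vee(\psi\,\text{⩔}\,\chi)$ infer $(\phi\vee\psi)\,\text{⩔}\,(\phi\vee\chi)$. $\Gamma\vdash\phi$ means $\phi$ is derivable from assumptions in $\Gamma$. -}

module Defs where

open import Data.Nat using (ℕ)
open import Data.List using (List; _∷_)
open import Data.List.Membership.Propositional using (_∈_)

-- Formulas of PL(⩔); propositional variables indexed by ℕ.
-- _∨_ is local (tensor) disjunction, _⩔_ is global disjunction.
infixr 30 _∧_
infixr 25 _∨_
infixr 20 _⩔_
infix 40 ¬'_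
data Form : Set where
  var : ℕ → Form
  ⊥'  : Form
  ¬'_ : Form → Form
  _∧_ : Form → Form → Form
  _∨_ : Form → Form → Form
  _⩔_ : Form → Form → Form

data Classical : Form → Set where
  c-var : ∀ p → Classical (var p)
  c-⊥   : Classical ⊥'
  c-¬   : ∀ {a} → Classical a → Classical (¬' a)
  c-∧   : ∀ {a b} → Classical a → Classical b → Classical (a ∧ b)
  c-∨   : ∀ {a b} → Classical a → Classical b → Classical (a ∨ b)

-- Natural deduction: Γ ⊢ φ. Assumption sets are lists; discharging [φ]
-- in a subderivation corresponds to adding φ to the context.
infix 10 _⊢_
data _⊢_ (Γ : List Form) : Form → Set where
  assm : ∀ {φ} → φ ∈ Γ → Γ ⊢ φ
  ⊥E   : ∀ {φ} → Γ ⊢ ⊥' → Γ ⊢ φ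
  ∧I   : ∀ {φ ψ} → Γ ⊢ φ → Γ ⊢ ψ → Γ ⊢ φ ∧ ψ
  ∧E₁  : ∀ {φ ψ} → Γ ⊢ φ ∧ ψ → Γ ⊢ φ
  ∧E₂  : ∀ {φ ψ} → Γ ⊢ φ ∧ ψ → Γ ⊢ ψ
  ¬I   : ∀ {φ} → (φ ∷ Γ) ⊢ ⊥' → Γ ⊢ ¬' φ
  ¬E   : ∀ {φ ψ} → Γ ⊢ φ → Γ ⊢ ¬' φ → Γ ⊢ ψ
  RAA  : ∀ {α} → Classical α → ((¬' α) ∷ Γ) ⊢ ⊥' → Γ ⊢ α
  ⩔I₁  : ∀ {φ ψ} → Γ ⊢ φ → Γ ⊢ φ ⩔ ψ
  ⩔I₂  : ∀ {φ ψ} → Γ ⊢ φ → Γ ⊢ ψ ⩔ φ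
  ⩔E   : ∀ {φ ψ χ} → Γ ⊢ φ ⩔ ψ → (φ ∷ Γ) ⊢ χ → (ψ ∷ Γ) ⊢ χ → Γ ⊢ χ
  ∨I   : ∀ {φ ψ} → Γ ⊢ φ → Γ ⊢ φ ∨ ψ
  ∨E   : ∀ {φ ψ α} → Classical α → Γ ⊢ φ ∨ ψ → (φ ∷ Γ) ⊢ α → (ψ ∷ Γ) ⊢ α → Γ ⊢ α
  ∨Com : ∀ {φ ψ} → Γ ⊢ φ ∨ ψ → Γ ⊢ ψ ∨ φ
  ∨Mon : ∀ {φ ψ χ} → Γ ⊢ φ ∨ ψ → (φ ∷ Γ) ⊢ χ → Γ ⊢ χ ∨ ψ
  Dis∨⩔ : ∀ {φ ψ χ} → Γ ⊢ φ ∨ (ψ ⩔ χ) → Γ ⊢ (φ ∨ ψ) ⩔ (φ ∨ χ)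

{-# OPTIONS --safe #-}
-- Every formula is interderivable with a global disjunction ⩔ᵢ αᵢ of classical
-- formulas: ∧, ∨ and ¬ are pushed through ⩔ by distributivity (Dis∨⩔ for ∨)
-- and De Morgan. For such normal forms both rules are proved by induction:
-- Dis∨⩔ splits α ∨ (φ₁ ⩔ φ₂) into the two cases, and at classical leaves the
-- conclusion is classical, so the local disjunction may be eliminated by ∨E.
module Submission where

open import Defs
open import Data.Product using (_×_; _,_)
open import Data.List using (List; _∷_; [])
open import Data.List.Relation.Binary.Subset.Propositional using (_⊆_)
open import Data.List.Relation.Binary.Subset.Propositional.Properties using (∷⁺ʳ)
open import Data.List.Relation.Unary.Any using (here; there)
open import Relation.Binary.PropositionalEquality using (refl)

private
  variable
    Γ Δ : List Form
    α φ φ′ ψ ψ′ χ : Form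

weaken : Γ ⊆ Δ → Γ ⊢ φ → Δ ⊢ φ
weaken s (assm x)      = assm (s x)
weaken s (⊥E d)        = ⊥E (weaken s d)
weaken s (∧I d e)      = ∧I (weaken s d) (weaken s e)
weaken s (∧E₁ d)       = ∧E₁ (weaken s d)
weaken s (∧E₂ d)       = ∧E₂ (weaken s d)
weaken s (¬I d)        = ¬I (weaken (∷⁺ʳ _ s) d)
weaken s (¬E d e)      = ¬E (weaken s d) (weaken s e)
weaken s (RAA c d)     = RAA c (weaken (∷⁺ʳ _ s) d)
weaken s (⩔I₁ d)       = ⩔I₁ (weaken s d)
weaken s (⩔I₂ d)       = ⩔I₂ (weaken s d)
weaken s (⩔E d e f)    = ⩔E (weaken s d) (weaken (∷⁺ʳ _ s) e) (weaken (∷⁺ʳ _ s) f)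
weaken s (∨I d)        = ∨I (weaken s d)
weaken s (∨E c d e f)  = ∨E c (weaken s d) (weaken (∷⁺ʳ _ s) e) (weaken (∷⁺ʳ _ s) f)
weaken s (∨Com d)      = ∨Com (weaken s d)
weaken s (∨Mon d e)    = ∨Mon (weaken s d) (weaken (∷⁺ʳ _ s) e)
weaken s (Dis∨⩔ d)     = Dis∨⩔ (weaken s d)

wk : Γ ⊢ φ → (ψ ∷ Γ) ⊢ φ
wk = weaken there

hyp : (φ ∷ Γ) ⊢ φ
hyp = assm (here refl)

infix 5 _⇒_ _⊣⊢_

_⇒_ : Form → Form → Set
φ ⇒ ψ = ∀ {Γ} → Γ ⊢ φ → Γ ⊢ ψ

record _⊣⊢_ (φ ψ : Form) : Set where
  constructor mk⊣⊢
  field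
    to   : φ ⇒ ψ
    from : ψ ⇒ φ

open _⊣⊢_

⊣⊢-refl : φ ⊣⊢ φ
⊣⊢-refl = mk⊣⊢ (λ d → d) (λ d → d)

⊣⊢-trans : φ ⊣⊢ ψ → ψ ⊣⊢ χ → φ ⊣⊢ χ
⊣⊢-trans e f = mk⊣⊢ (λ d → to f (to e d)) (λ d → from e (from f d))

∧-cong : φ ⊣⊢ φ′ → ψ ⊣⊢ ψ′ → φ ∧ ψ ⊣⊢ φ′ ∧ ψ′
∧-cong e f = mk⊣⊢ (λ d → ∧I (to e (∧E₁ d)) (to f (∧E₂ d)))
                  (λ d → ∧I (from e (∧E₁ d)) (from f (∧E₂ d)))

∧-comm : φ ∧ ψ ⊣⊢ ψ ∧ φ
∧-comm = mk⊣⊢ (λ d → ∧I (∧E₂ d) (∧E₁ d)) (λ d → ∧I (∧E₂ d) (∧E₁ d))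

⩔-mono : φ ⇒ φ′ → ψ ⇒ ψ′ → φ ⩔ ψ ⇒ φ′ ⩔ ψ′
⩔-mono f g d = ⩔E d (⩔I₁ (f hyp)) (⩔I₂ (g hyp))

⩔-cong : φ ⊣⊢ φ′ → ψ ⊣⊢ ψ′ → φ ⩔ ψ ⊣⊢ φ′ ⩔ ψ′
⩔-cong e f = mk⊣⊢ (⩔-mono (to e) (to f)) (⩔-mono (from e) (from f))

∨-monoˡ : φ ⇒ φ′ → φ ∨ ψ ⇒ φ′ ∨ ψ
∨-monoˡ f d = ∨Mon d (f hyp)

∨-monoʳ : ψ ⇒ ψ′ → φ ∨ ψ ⇒ φ ∨ ψ′
∨-monoʳ g d = ∨Com (∨-monoˡ g (∨Com d))

∨-mono : φ ⇒ φ′ → ψ ⇒ ψ′ → φ ∨ ψ ⇒ φ′ ∨ ψ′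
∨-mono f g d = ∨-monoˡ f (∨-monoʳ g d)

∨-cong : φ ⊣⊢ φ′ → ψ ⊣⊢ ψ′ → φ ∨ ψ ⊣⊢ φ′ ∨ ψ′
∨-cong e f = mk⊣⊢ (∨-mono (to e) (to f)) (∨-mono (from e) (from f))

∨-comm : φ ∨ ψ ⊣⊢ ψ ∨ φ
∨-comm = mk⊣⊢ ∨Com ∨Com

¬-anti : ψ ⇒ φ → ¬' φ ⇒ ¬' ψ
¬-anti f d = ¬I (¬E (f hyp) (wk d))

¬-cong : φ ⊣⊢ ψ → ¬' φ ⊣⊢ ¬' ψ
¬-cong e = mk⊣⊢ (¬-anti (from e)) (¬-anti (to e))

∧-distribˡ-⩔ : χ ∧ (φ ⩔ ψ) ⊣⊢ (χ ∧ φ) ⩔ (χ ∧ ψ)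
∧-distribˡ-⩔ = mk⊣⊢
  (λ d → ⩔E (∧E₂ d) (⩔I₁ (∧I (wk (∧E₁ d)) hyp)) (⩔I₂ (∧I (wk (∧E₁ d)) hyp)))
  (λ d → ∧I (⩔E d (∧E₁ hyp) (∧E₁ hyp)) (⩔-mono ∧E₂ ∧E₂ d))

∧-distribʳ-⩔ : (φ ⩔ ψ) ∧ χ ⊣⊢ (φ ∧ χ) ⩔ (ψ ∧ χ)
∧-distribʳ-⩔ = ⊣⊢-trans ∧-comm (⊣⊢-trans ∧-distribˡ-⩔ (⩔-cong ∧-comm ∧-comm))

∨-distribˡ-⩔ : χ ∨ (φ ⩔ ψ) ⊣⊢ (χ ∨ φ) ⩔ (χ ∨ ψ)
∨-distribˡ-⩔ = mk⊣⊢ Dis∨⩔ (λ d → ⩔E d (∨-monoʳ ⩔I₁ hyp) (∨-monoʳ ⩔I₂ hyp))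

∨-distribʳ-⩔ : (φ ⩔ ψ) ∨ χ ⊣⊢ (φ ∨ χ) ⩔ (ψ ∨ χ)
∨-distribʳ-⩔ = ⊣⊢-trans ∨-comm (⊣⊢-trans ∨-distribˡ-⩔ (⩔-cong ∨-comm ∨-comm))

¬-⩔ : ¬' (φ ⩔ ψ) ⊣⊢ ¬' φ ∧ ¬' ψ
¬-⩔ = mk⊣⊢
  (λ d → ∧I (¬-anti ⩔I₁ d) (¬-anti ⩔I₂ d))
  (λ d → ¬I (⩔E hyp (¬E hyp (wk (wk (∧E₁ d)))) (¬E hyp (wk (wk (∧E₂ d))))))

infixr 20 _⩔ₙ_

data Normal : Form → Set where
  classical : Classical α → Normal α
  _⩔ₙ_      : Normal φ → Normal ψ → Normal (φ ⩔ ψ)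

record NormalForm (φ : Form) : Set where
  field
    form   : Form
    normal : Normal form
    equiv  : φ ⊣⊢ form

classicalNormalForm : Classical α → NormalForm α
classicalNormalForm c = record { form = _ ; normal = classical c ; equiv = ⊣⊢-refl }

normalForm-⊣⊢ : φ ⊣⊢ ψ → NormalForm ψ → NormalForm φ
normalForm-⊣⊢ e N = record { form = form ; normal = normal ; equiv = ⊣⊢-trans e equiv }
  where open NormalForm N

⩔-normalForm : φ ⊣⊢ ψ ⩔ χ → NormalForm ψ → NormalForm χ → NormalForm φ
⩔-normalForm e L R = record
  { form   = L.form ⩔ R.form
  ; normal = L.normal ⩔ₙ R.normal
  ; equiv  = ⊣⊢-trans e (⩔-cong L.equiv R.equiv)
  }
  where
    module L = NormalForm L
    module R = NormalForm R

∧-normal : Normal φ → Normal ψ → NormalForm (φ ∧ ψ)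
∧-normal (classical a) (classical b) = classicalNormalForm (c-∧ a b)
∧-normal m (l ⩔ₙ r) = ⩔-normalForm ∧-distribˡ-⩔ (∧-normal m l) (∧-normal m r)
∧-normal (l ⩔ₙ r) n = ⩔-normalForm ∧-distribʳ-⩔ (∧-normal l n) (∧-normal r n)

∨-normal : Normal φ → Normal ψ → NormalForm (φ ∨ ψ)
∨-normal (classical a) (classical b) = classicalNormalForm (c-∨ a b)
∨-normal m (l ⩔ₙ r) = ⩔-normalForm ∨-distribˡ-⩔ (∨-normal m l) (∨-normal m r)
∨-normal (l ⩔ₙ r) n = ⩔-normalForm ∨-distribʳ-⩔ (∨-normal l n) (∨-normal r n)

∧-normalForm : NormalForm φ → NormalForm ψ → NormalForm (φ ∧ ψ)
∧-normalForm L R = normalForm-⊣⊢ (∧-cong L.equiv R.equiv) (∧-normal L.normal R.normal)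
  where
    module L = NormalForm L
    module R = NormalForm R

∨-normalForm : NormalForm φ → NormalForm ψ → NormalForm (φ ∨ ψ)
∨-normalForm L R = normalForm-⊣⊢ (∨-cong L.equiv R.equiv) (∨-normal L.normal R.normal)
  where
    module L = NormalForm L
    module R = NormalForm R

¬-normal : Normal φ → NormalForm (¬' φ)
¬-normal (classical a) = classicalNormalForm (c-¬ a)
¬-normal (l ⩔ₙ r)      = normalForm-⊣⊢ ¬-⩔ (∧-normalForm (¬-normal l) (¬-normal r))

¬-normalForm : NormalForm φ → NormalForm (¬' φ)
¬-normalForm N = normalForm-⊣⊢ (¬-cong equiv) (¬-normal normal)
  where open NormalForm N

normalForm : ∀ φ → NormalForm φ
normalForm (var p) = classicalNormalForm (c-var p)
normalForm ⊥'      = classicalNormalForm c-⊥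
normalForm (¬' φ)  = ¬-normalForm (normalForm φ)
normalForm (φ ∧ ψ) = ∧-normalForm (normalForm φ) (normalForm ψ)
normalForm (φ ∨ ψ) = ∨-normalForm (normalForm φ) (normalForm ψ)
normalForm (φ ⩔ ψ) = ⩔-normalForm ⊣⊢-refl (normalForm φ) (normalForm ψ)

syllogism-normal : Normal φ → Γ ⊢ α ∨ φ → Γ ⊢ ¬' α → Γ ⊢ φ
syllogism-normal (classical a) d n = ∨E a d (¬E hyp (wk n)) hyp
syllogism-normal (l ⩔ₙ r) d n =
  ⩔E (Dis∨⩔ d) (⩔I₁ (syllogism-normal l hyp (wk n))) (⩔I₂ (syllogism-normal r hyp (wk n)))

disjunctive-syllogism : Γ ⊢ α ∨ φ → Γ ⊢ ¬' α → Γ ⊢ φ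
disjunctive-syllogism {φ = φ} d n = from equiv (syllogism-normal normal (∨-monoʳ (to equiv) d) n)
  where open NormalForm (normalForm φ)

resolution-normal : Normal φ → Normal ψ → Γ ⊢ α ∨ φ → Γ ⊢ ¬' α ∨ ψ → Γ ⊢ φ ∨ ψ
resolution-normal (classical a) (classical b) d e =
  ∨E (c-∨ a b) d (∨E (c-∨ a b) (wk e) (¬E (wk hyp) hyp) (∨Com (∨I hyp))) (∨I hyp)
resolution-normal m (l ⩔ₙ r) d e =
  ⩔E (Dis∨⩔ e) (∨-monoʳ ⩔I₁ (resolution-normal m l (wk d) hyp))
               (∨-monoʳ ⩔I₂ (resolution-normal m r (wk d) hyp))
resolution-normal (l ⩔ₙ r) n d e =
  ⩔E (Dis∨⩔ d) (∨-monoˡ ⩔I₁ (resolution-normal l n hyp (wk e)))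
               (∨-monoˡ ⩔I₂ (resolution-normal r n hyp (wk e)))

resolution : Γ ⊢ α ∨ φ → Γ ⊢ ¬' α ∨ ψ → Γ ⊢ φ ∨ ψ
resolution {φ = φ} {ψ = ψ} d e =
  ∨-mono (from Nφ.equiv) (from Nψ.equiv)
    (resolution-normal Nφ.normal Nψ.normal (∨-monoʳ (to Nφ.equiv) d) (∨-monoʳ (to Nψ.equiv) e))
  where
    module Nφ = NormalForm (normalForm φ)
    module Nψ = NormalForm (normalForm ψ)

-- Neither rule needs α to be classical.
mainTheorem12 : ∀ (α φ ψ : Form) → Classical α →
    (((α ∨ φ) ∷ (¬' α) ∷ []) ⊢ φ) × (((α ∨ φ) ∷ ((¬' α) ∨ ψ) ∷ []) ⊢ φ ∨ ψ)
mainTheorem12 α φ ψ _ =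
  disjunctive-syllogism (assm (here refl)) (assm (there (here refl))) ,
  resolution (assm (here refl)) (assm (there (here refl)))
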